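{- Let $(G,S,k)$ be an instance of \textsc{Edge Subset Feedback Vertex Set}, let $T=V(S)$, let $X$ be a dominant solution, and let $X_0=X\setminus T$. Then every nonempty set $Y\subseteq X_0$ sees at least $|Y|+2$ interesting components of $G-X-S$.
   Context: Graphs are finite and undirected and may contain loops and multi-edges. For $G=(V,E)$ and $S\subseteq E$, an $S$-cycle is a cycle containing at least one edge of $S$. Solutions of $(G,S,k)$ are the sets $X\subseteq V$ with $|X|\le k$ such that $G-X$ has no $S$-cycle. $V(S)$ is the set of endpoints of edges of $S$. A solution $X$ is dominant if it has minimum size among all solutions and, among solutions of minimum size, contains the maximum number of vertices of $T$. $G-X-S$ is the graph obtained from $G-X$ by deleting all edges of $S$. A connected component $K$ of $G-X-S$ is interesting if it contains a vertex of $T$. A vertex $y\in X_0$ sees an interesting component $K$ if $y$ is adjacent in $G$ to a vertex of $K$. A set $Y\subseteq X_0$ sees $K$ if some $y\in Y$ sees $K$. -}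

module Defs where

open import Data.Nat as ℕ using (ℕ; suc; _≤_; _+_; s≤s)
open import Data.Fin using (Fin; zero; toℕ; fromℕ<)
open import Data.Fin.Subset using (Subset; _∈_; _∉_; _⊆_; _∩_; _─_; ∣_∣; Nonempty)
open import Data.Product using (Σ; ∃; _×_; _,_; proj₁; proj₂)
open import Data.Sum using (_⊎_)
open import Relation.Nullary using (¬_; yes; no)
open import Relation.Binary.PropositionalEquality using (_≡_; _≢_)
open import Relation.Binary.Construct.Closure.ReflexiveTransitive using (Star)
open import Function.Definitions using (Injective)

-- A finite multigraph (loops and parallel edges allowed):
-- vertices Fin n, edges Fin m, each edge has an (unordered) pair of endpoints.
record Graph : Set where
  field
    n    : ℕ
    m    : ℕ
    ends : Fin m → Fin n × Fin n

module _ (G : Graph) where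
  open Graph G

  Vertex : Set
  Vertex = Fin n

  Edge : Set
  Edge = Fin m

  Joins : Edge → Vertex → Vertex → Set
  Joins e a b = (ends e ≡ (a , b)) ⊎ (ends e ≡ (b , a))

  Incident : Edge → Vertex → Set
  Incident e v = (proj₁ (ends e) ≡ v) ⊎ (proj₂ (ends e) ≡ v)

  IsEndpointsOf : Subset m → Subset n → Set
  IsEndpointsOf S T = ∀ v → (v ∈ T → ∃ λ e → e ∈ S × Incident e v)
                          × ((∃ λ e → e ∈ S × Incident e v) → v ∈ T)

  Adj : Vertex → Vertex → Set
  Adj a b = ∃ λ e → Joins e a b

next : ∀ {l} → Fin (suc l) → Fin (suc l)
next {l} i with toℕ i ℕ.<? l
... | yes p = fromℕ< (s≤s p)
... | no _  = zero

module _ (G : Graph) where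
  open Graph G

  -- A cycle of length suc l in G - X: distinct vertices vs 0 .. vs l, distinct
  -- edges es 0 .. es l, edge es i joining vs i and vs (i+1 mod (suc l)),
  -- all vertices outside X.  (Length 1 = loop, length 2 = two parallel edges.)
  record CycleAvoiding (X : Subset n) : Set where
    field
      l      : ℕ
      vs     : Fin (suc l) → Fin n
      es     : Fin (suc l) → Fin m
      vs-inj : Injective _≡_ _≡_ vs
      es-inj : Injective _≡_ _≡_ es
      joins  : ∀ i → Joins G (es i) (vs i) (vs (next i))
      avoid  : ∀ i → vs i ∉ X

  HasSCycle : Subset m → Subset n → Set
  HasSCycle S X = Σ (CycleAvoiding X) λ C →
                    ∃ λ i → CycleAvoiding.es C i ∈ S

  IsSolution : Subset m → ℕ → Subset n → Set
  IsSolution S k X = ∣ X ∣ ≤ k × ¬ HasSCycle S X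

  IsDominant : Subset m → ℕ → Subset n → Subset n → Set
  IsDominant S k T X =
      IsSolution S k X
    × (∀ Z → IsSolution S k Z → ∣ X ∣ ≤ ∣ Z ∣)
    × (∀ Z → IsSolution S k Z → ∣ Z ∣ ≡ ∣ X ∣ → ∣ Z ∩ T ∣ ≤ ∣ X ∩ T ∣)

  Step : Subset m → Subset n → Fin n → Fin n → Set
  Step S X a b = a ∉ X × b ∉ X × ∃ λ e → e ∉ S × Joins G e a b

  -- same connected component of G - X - S (for vertices outside X)
  Conn : Subset m → Subset n → Fin n → Fin n → Set
  Conn S X = Star (Step S X)

  Interesting : Subset m → Subset n → Subset n → Fin n → Set
  Interesting S X T v = ∃ λ t → t ∈ T × Conn S X v t

  Sees : Subset m → Subset n → Subset n → Fin n → Set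
  Sees S X Y v = ∃ λ y → y ∈ Y × ∃ λ u → Conn S X v u × Adj G y u

  -- Y sees at least c interesting components of G - X - S:
  -- there are c vertices outside X, in pairwise distinct components,
  -- each component interesting and seen by Y.
  SeesAtLeast : Subset m → Subset n → Subset n → Subset n → ℕ → Set
  SeesAtLeast S X T Y c =
    Σ (Fin c → Fin n) λ r →
        (∀ i → r i ∉ X)
      × (∀ i j → i ≢ j → ¬ Conn S X (r i) (r j))
      × (∀ i → Interesting S X T (r i))
      × (∀ i → Sees S X Y (r i))

module Submission where

-- Suppose Y saw at most ∣Y∣ + 1 interesting components, with representatives r₀, …, r_{c−1}.
-- Group them by the components of G − X; the representative of least index in a group is its
-- root, and every other r_j is joined to its root by a walk in G − X that starts in the component
-- of r_j in G − X − S and is shortest among all such walks. Its first edge is an S-edge, so its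
-- first vertex s_j lies in T. Put W = {s_j : r_j not a root}, so ∣W∣ ≤ c − 1 ≤ ∣Y∣, and
-- Z = (X − Y) ∪ W. An S-cycle of G − Z must meet Y (otherwise it lives in G − X); leaving Y on
-- both sides of one of its S-edges, it links two interesting components seen by Y through
-- G − X − W. If they are the same component, or one of them is a root, this closes an S-cycle
-- in G − X; otherwise each of the two shortest walks is strictly shorter than the other. So Z
-- is a solution of size at most ∣X∣; by minimality ∣W∣ = ∣Y∣ ≥ 1, and Z contains more vertices
-- of T than X, contradicting dominance.

open import Defs
open import Data.Nat as ℕ using (ℕ; zero; suc; _+_; _≤_; _<_; z≤n; s≤s)
import Data.Nat.Properties as ℕ
open import Data.Fin as Fin using (Fin; zero; suc; toℕ; fromℕ; fromℕ<; inject; inject₁; inject≤)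
import Data.Fin.Properties as Fin
open import Data.Fin.Subset
  using (Subset; _∈_; _∉_; _⊆_; _⊂_; _∪_; _∩_; _─_; ∣_∣; ⁅_⁆; Nonempty; inside; outside)
  renaming (⊥ to ∅)
open import Data.Fin.Subset.Properties
  using ( _∈?_; _⊂?_; drop-∷-⊆; p⊆q⇒∣p∣≤∣q∣; p⊂q⇒∣p∣<∣q∣; ∣p∣≤n; ∣⊥∣≡0; ∣⁅x⁆∣≡1; x∈⁅x⁆; x∈⁅y⁆⇒x≡y
        ; x∈p∪q⁺; x∈p∪q⁻; x∈p∩q⁺; x∈p∩q⁻; x∈p∧x∉q⇒x∈p─q; p─q⊆p; p⊆p∪q)
open import Data.Vec using ([]; _∷_; here; there; tabulate)
open import Data.Vec.Properties using (lookup∘tabulate; []=⇒lookup; lookup⇒[]=)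
open import Data.Bool using (T)
open import Data.Bool.Properties using (T-≡)
open import Data.List using (List; []; _∷_; _++_; length; allFin)
open import Data.List.Properties using (length-++)
open import Data.List.Relation.Unary.Any using (here; there; any?)
import Data.List.Relation.Unary.Any.Properties as Any
open import Data.List.Relation.Unary.All using (All; []; _∷_)
open import Data.List.Relation.Unary.All.Properties using (All¬⇒¬Any; ¬Any⇒All¬)
open import Data.List.Membership.Propositional using () renaming (_∈_ to _∈ₗ_; _∉_ to _∉ₗ_)
open import Data.List.Membership.Propositional.Properties using (∈-++⁺ˡ; ∈-++⁺ʳ; ∈-++⁻; ∈-allFin)
open import Data.List.Relation.Binary.Subset.Propositional using () renaming (_⊆_ to _⊆ₗ_)
open import Data.Product using (Σ; ∃; _×_; _,_; proj₁; proj₂)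
open import Data.Product.Properties using (,-injective; ≡-dec)
open import Data.Sum using (_⊎_; inj₁; inj₂; [_,_]′)
open import Data.Unit using (tt)
open import Data.Empty using (⊥; ⊥-elim)
open import Function using (_∘_; id)
open import Function.Bundles using (Equivalence)
open import Function.Definitions using (Injective)
open import Level using (0ℓ)
open import Relation.Nullary using (¬_; ¬?; Dec; yes; no; does; contradiction)
open import Relation.Nullary.Decidable
  using (decidable-stable; dec-true; isYes≗does; toWitness; map′; _⊎-dec_; _×-dec_)
open import Relation.Unary using (Pred; Decidable; U)
open import Relation.Binary using (Rel)
import Relation.Binary as B
open import Relation.Binary.Construct.Closure.ReflexiveTransitive using (Star; ε; _◅_; _◅◅_; gmap; reverse)
open import Relation.Binary.PropositionalEquality using (_≡_; _≢_; refl; sym; trans; cong; subst; subst₂)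

least-Fin : ∀ {n} {P : Pred (Fin n) 0ℓ} → Decidable P → ∀ {j} → P j →
            ∃ λ i → P i × (∀ k → k Fin.< i → ¬ P k)
least-Fin {n} {P} P? {j} pj with Fin.¬∀⟶∃¬-smallest n (¬_ ∘ P) (¬? ∘ P?) (λ ∀¬P → ∀¬P j pj)
... | i , ¬¬Pi , below = i , decidable-stable (P? i) ¬¬Pi , minimal
  where
  minimal : ∀ k → k Fin.< i → ¬ P k
  minimal k k<i = subst (¬_ ∘ P) inject-fromℕ<≡k (below (fromℕ< k<i))
    where
    inject-fromℕ<≡k : inject (fromℕ< k<i) ≡ k
    inject-fromℕ<≡k = Fin.toℕ-injective (trans (Fin.toℕ-inject _) (Fin.toℕ-fromℕ< k<i))

least-ℕ : ∀ {P : Pred ℕ 0ℓ} → Decidable P → ∀ {n} → P n → ∃ λ m → P m × (∀ {k} → k < m → ¬ P k)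
least-ℕ {P} P? {n} pn with least-Fin {P = P ∘ toℕ} (P? ∘ toℕ) {fromℕ n} (subst P (sym (Fin.toℕ-fromℕ n)) pn)
... | i , pi , minimal = toℕ i , pi , λ {k} k<i → subst (¬_ ∘ P) (Fin.toℕ-fromℕ< _)
        (minimal (fromℕ< (ℕ.<-trans k<i (Fin.toℕ<n i))) (subst (_< toℕ i) (sym (Fin.toℕ-fromℕ< _)) k<i))

∣p─q∣+∣q∣≡∣p∣ : ∀ {n} (p q : Subset n) → q ⊆ p → ∣ p ─ q ∣ + ∣ q ∣ ≡ ∣ p ∣
∣p─q∣+∣q∣≡∣p∣ [] [] _ = refl
∣p─q∣+∣q∣≡∣p∣ (inside ∷ p) (inside ∷ q) q⊆p =
  trans (ℕ.+-suc ∣ p ─ q ∣ ∣ q ∣) (cong suc (∣p─q∣+∣q∣≡∣p∣ p q (drop-∷-⊆ q⊆p)))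
∣p─q∣+∣q∣≡∣p∣ (inside ∷ p) (outside ∷ q) q⊆p = cong suc (∣p─q∣+∣q∣≡∣p∣ p q (drop-∷-⊆ q⊆p))
∣p─q∣+∣q∣≡∣p∣ (outside ∷ p) (inside ∷ q) q⊆p with () ← q⊆p here
∣p─q∣+∣q∣≡∣p∣ (outside ∷ p) (outside ∷ q) q⊆p = ∣p─q∣+∣q∣≡∣p∣ p q (drop-∷-⊆ q⊆p)

∣p∪q∣≤∣p∣+∣q∣ : ∀ {n} (p q : Subset n) → ∣ p ∪ q ∣ ≤ ∣ p ∣ + ∣ q ∣
∣p∪q∣≤∣p∣+∣q∣ [] [] = z≤n
∣p∪q∣≤∣p∣+∣q∣ (inside ∷ p) (inside ∷ q) =
  s≤s (ℕ.≤-trans (∣p∪q∣≤∣p∣+∣q∣ p q) (ℕ.≤-trans (ℕ.n≤1+n _) (ℕ.≤-reflexive (sym (ℕ.+-suc ∣ p ∣ ∣ q ∣)))))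
∣p∪q∣≤∣p∣+∣q∣ (inside ∷ p) (outside ∷ q) = s≤s (∣p∪q∣≤∣p∣+∣q∣ p q)
∣p∪q∣≤∣p∣+∣q∣ (outside ∷ p) (inside ∷ q) =
  ℕ.≤-trans (s≤s (∣p∪q∣≤∣p∣+∣q∣ p q)) (ℕ.≤-reflexive (sym (ℕ.+-suc ∣ p ∣ ∣ q ∣)))
∣p∪q∣≤∣p∣+∣q∣ (outside ∷ p) (outside ∷ q) = ∣p∪q∣≤∣p∣+∣q∣ p q

∣p∣+∣q∣≤∣p∪q∣ : ∀ {n} (p q : Subset n) → (∀ {x} → x ∈ p → x ∉ q) → ∣ p ∣ + ∣ q ∣ ≤ ∣ p ∪ q ∣
∣p∣+∣q∣≤∣p∪q∣ [] [] _ = z≤n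
∣p∣+∣q∣≤∣p∪q∣ (inside ∷ p) (inside ∷ q) p#q = ⊥-elim (p#q here here)
∣p∣+∣q∣≤∣p∪q∣ (inside ∷ p) (outside ∷ q) p#q = s≤s (∣p∣+∣q∣≤∣p∪q∣ p q (λ x∈p x∈q → p#q (there x∈p) (there x∈q)))
∣p∣+∣q∣≤∣p∪q∣ (outside ∷ p) (inside ∷ q) p#q =
  ℕ.≤-trans (ℕ.≤-reflexive (ℕ.+-suc ∣ p ∣ ∣ q ∣))
            (s≤s (∣p∣+∣q∣≤∣p∪q∣ p q (λ x∈p x∈q → p#q (there x∈p) (there x∈q))))
∣p∣+∣q∣≤∣p∪q∣ (outside ∷ p) (outside ∷ q) p#q = ∣p∣+∣q∣≤∣p∪q∣ p q (λ x∈p x∈q → p#q (there x∈p) (there x∈q))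

module _ {n} {P : Pred (Fin n) 0ℓ} (P? : Decidable P) where

  subsetOf : Subset n
  subsetOf = tabulate (does ∘ P?)

  ∈-subsetOf⁺ : ∀ {i} → P i → i ∈ subsetOf
  ∈-subsetOf⁺ {i} p = lookup⇒[]= i _ (trans (lookup∘tabulate _ i) (dec-true (P? i) p))

  ∈-subsetOf⁻ : ∀ {i} → i ∈ subsetOf → P i
  ∈-subsetOf⁻ {i} i∈ =
    toWitness (subst T (sym (isYes≗does (P? i)))
      (Equivalence.from T-≡ (trans (sym (lookup∘tabulate _ i)) ([]=⇒lookup i∈))))

-- The sets of vertices reachable from a in at most k steps grow strictly with k until they
-- stabilise, so n rounds reach everything.
module _ {n} {R : Rel (Fin n) 0ℓ} (R? : B.Decidable R) where

  private
    OneStep : Subset n → Pred (Fin n) 0ℓ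
    OneStep s v = v ∈ s ⊎ ∃ λ u → u ∈ s × R u v

    oneStep? : ∀ s → Decidable (OneStep s)
    oneStep? s v = (v ∈? s) ⊎-dec Fin.any? (λ u → (u ∈? s) ×-dec R? u v)

    expand : Subset n → Subset n
    expand s = subsetOf (oneStep? s)

    s⊆expand : ∀ s → s ⊆ expand s
    s⊆expand s x∈ = ∈-subsetOf⁺ (oneStep? s) (inj₁ x∈)

    expand-mono : ∀ {s t} → s ⊆ t → expand s ⊆ expand t
    expand-mono {s} {t} s⊆t x∈ with ∈-subsetOf⁻ (oneStep? s) x∈
    ... | inj₁ x∈s = ∈-subsetOf⁺ (oneStep? t) (inj₁ (s⊆t x∈s))
    ... | inj₂ (u , u∈s , r) = ∈-subsetOf⁺ (oneStep? t) (inj₂ (u , s⊆t u∈s , r))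

    stable-or-grows : ∀ s → expand s ⊆ s ⊎ s ⊂ expand s
    stable-or-grows s with s ⊂? expand s
    ... | yes s⊂ = inj₂ s⊂
    ... | no ¬s⊂ = inj₁ λ {x} x∈ → decidable-stable (x ∈? s) (λ x∉ → ¬s⊂ (s⊆expand s , x , x∈ , x∉))

    module _ (a : Fin n) where
      reach : ℕ → Subset n
      reach zero = ⁅ a ⁆
      reach (suc k) = expand (reach k)

      a∈reach : ∀ k → a ∈ reach k
      a∈reach zero = x∈⁅x⁆ a
      a∈reach (suc k) = s⊆expand _ (a∈reach k)

      reach-sound : ∀ k {v} → v ∈ reach k → Star R a v
      reach-sound zero v∈ with refl ← x∈⁅y⁆⇒x≡y a v∈ = ε
      reach-sound (suc k) v∈ with ∈-subsetOf⁻ (oneStep? (reach k)) v∈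
      ... | inj₁ v∈′ = reach-sound k v∈′
      ... | inj₂ (u , u∈ , r) = reach-sound k u∈ ◅◅ (r ◅ ε)

      stable-or-large : ∀ k → expand (reach k) ⊆ reach k ⊎ suc k ≤ ∣ reach k ∣
      stable-or-large zero = inj₂ (ℕ.≤-reflexive (sym (∣⁅x⁆∣≡1 a)))
      stable-or-large (suc k) with stable-or-large k | stable-or-grows (reach k)
      ... | inj₁ stable | _ = inj₁ (expand-mono stable)
      ... | inj₂ _ | inj₁ stable = inj₁ (expand-mono stable)
      ... | inj₂ large | inj₂ grows = inj₂ (ℕ.≤-trans (s≤s large) (p⊂q⇒∣p∣<∣q∣ grows))

      reach-stable : expand (reach n) ⊆ reach n
      reach-stable with stable-or-large n
      ... | inj₁ stable = stable
      ... | inj₂ large = contradiction (ℕ.≤-trans large (∣p∣≤n (reach n))) (ℕ.n≮n n)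

      reach-complete : ∀ {u v} → u ∈ reach n → Star R u v → v ∈ reach n
      reach-complete u∈ ε = u∈
      reach-complete u∈ (r ◅ rs) =
        reach-complete (reach-stable (∈-subsetOf⁺ (oneStep? (reach n)) (inj₂ (_ , u∈ , r)))) rs

  Star? : B.Decidable (Star R)
  Star? a b = map′ (reach-sound a n) (reach-complete a (a∈reach a n)) (b ∈? reach a n)

covered⇒∣p∣≤c : ∀ {n c} (f : Fin c → Fin n) (p : Subset n) → (∀ {x} → x ∈ p → ∃ λ i → x ≡ f i) → ∣ p ∣ ≤ c
covered⇒∣p∣≤c {n} {zero} f p covered =
  ℕ.≤-trans (p⊆q⇒∣p∣≤∣q∣ {q = ∅} (λ x∈ → ⊥-elim (Fin.¬Fin0 (proj₁ (covered x∈))))) (ℕ.≤-reflexive (∣⊥∣≡0 n))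
covered⇒∣p∣≤c {n} {suc c} f p covered = begin
  ∣ p ∣                      ≤⟨ p⊆q⇒∣p∣≤∣q∣ p⊆f0∪rest ⟩
  ∣ ⁅ f zero ⁆ ∪ rest ∣       ≤⟨ ∣p∪q∣≤∣p∣+∣q∣ ⁅ f zero ⁆ rest ⟩
  ∣ ⁅ f zero ⁆ ∣ + ∣ rest ∣   ≡⟨ cong (_+ ∣ rest ∣) (∣⁅x⁆∣≡1 (f zero)) ⟩
  suc ∣ rest ∣               ≤⟨ s≤s (covered⇒∣p∣≤c (f ∘ suc) rest (∈-subsetOf⁻ rest?)) ⟩
  suc c                      ∎
  where
  open ℕ.≤-Reasoning
  rest? : Decidable (λ x → ∃ λ i → x ≡ f (suc i))
  rest? x = Fin.any? (λ i → x Fin.≟ f (suc i))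
  rest : Subset n
  rest = subsetOf rest?
  p⊆f0∪rest : p ⊆ ⁅ f zero ⁆ ∪ rest
  p⊆f0∪rest x∈ with covered x∈
  ... | zero , refl = x∈p∪q⁺ (inj₁ (x∈⁅x⁆ _))
  ... | suc i , x≡ = x∈p∪q⁺ (inj₂ (∈-subsetOf⁺ rest? (i , x≡)))

covered∘suc⇒∣p∣≤c∸1 : ∀ {n c} (f : Fin c → Fin n) (p : Subset n) →
                      (∀ {x} → x ∈ p → ∃ λ i → 0 < toℕ i × x ≡ f i) → ∣ p ∣ ≤ c ℕ.∸ 1
covered∘suc⇒∣p∣≤c∸1 {c = zero} f p covered = covered⇒∣p∣≤c f p (λ x∈ → let i , _ , x≡ = covered x∈ in i , x≡)
covered∘suc⇒∣p∣≤c∸1 {c = suc c} f p covered = covered⇒∣p∣≤c (f ∘ suc) p covered-by-tail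
  where
  covered-by-tail : ∀ {x} → x ∈ p → ∃ λ i → x ≡ f (suc i)
  covered-by-tail x∈ with covered x∈
  ... | suc i , _ , x≡ = i , x≡

x∈p─q⇒x∉q : ∀ {n} {x : Fin n} (p q : Subset n) → x ∈ p ─ q → x ∉ q
x∈p─q⇒x∉q (_ ∷ p) (outside ∷ q) here ()
x∈p─q⇒x∉q (_ ∷ p) (_ ∷ q) (there x∈p─q) (there x∈q) = x∈p─q⇒x∉q p q x∈p─q x∈q

data Distinct {A : Set} : List A → Set where
  []  : Distinct []
  _∷_ : ∀ {x xs} → x ∉ₗ xs → Distinct xs → Distinct (x ∷ xs)

module _ {A : Set} where

  Distinct-++⁻ : ∀ xs {ys : List A} → Distinct (xs ++ ys) →
                 Distinct xs × Distinct ys × (∀ {x} → x ∈ₗ xs → x ∉ₗ ys)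
  Distinct-++⁻ [] d = [] , d , λ ()
  Distinct-++⁻ (x ∷ xs) (x∉ ∷ d) with Distinct-++⁻ xs d
  ... | dxs , dys , xs#ys = (x∉ ∘ ∈-++⁺ˡ) ∷ dxs , dys ,
        λ { (here refl) y∈ → x∉ (∈-++⁺ʳ xs y∈) ; (there z∈) → xs#ys z∈ }

  Distinct-++⁺ : ∀ xs {ys : List A} → Distinct xs → Distinct ys → (∀ {x} → x ∈ₗ xs → x ∉ₗ ys) →
                 Distinct (xs ++ ys)
  Distinct-++⁺ [] _ dys _ = dys
  Distinct-++⁺ (x ∷ xs) (x∉ ∷ dxs) dys xs#ys =
    [ x∉ , xs#ys (here refl) ]′ ∘ ∈-++⁻ xs ∷ Distinct-++⁺ xs dxs dys (xs#ys ∘ there)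

  Distinct-++-comm : ∀ xs {ys : List A} → Distinct (xs ++ ys) → Distinct (ys ++ xs)
  Distinct-++-comm xs {ys} d with Distinct-++⁻ xs d
  ... | dxs , dys , xs#ys = Distinct-++⁺ ys dys dxs (λ y∈ x∈ → xs#ys x∈ y∈)

  Distinct-++ʳ : ∀ xs {ys : List A} → Distinct (xs ++ ys) → Distinct ys
  Distinct-++ʳ xs = proj₁ ∘ proj₂ ∘ Distinct-++⁻ xs

next≡fromℕ< : ∀ {l} (i : Fin (suc l)) (i<l : toℕ i < l) → next i ≡ fromℕ< (s≤s i<l)
next≡fromℕ< {l} i i<l with toℕ i ℕ.<? l
... | yes _ = refl
... | no i≮l = ⊥-elim (i≮l i<l)

next≡zero : ∀ {l} (i : Fin (suc l)) → ¬ toℕ i < l → next i ≡ zero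
next≡zero {l} i i≮l with toℕ i ℕ.<? l
... | yes i<l = ⊥-elim (i≮l i<l)
... | no _ = refl

module _ (G : Graph) where
  open Graph G

  Joins-sym : ∀ {e a b} → Joins G e a b → Joins G e b a
  Joins-sym (inj₁ eq) = inj₂ eq
  Joins-sym (inj₂ eq) = inj₁ eq

  Joins⇒Incident : ∀ {e a b} → Joins G e a b → Incident G e a
  Joins⇒Incident (inj₁ eq) = inj₁ (cong proj₁ eq)
  Joins⇒Incident (inj₂ eq) = inj₂ (cong proj₂ eq)

  Joins-unique : ∀ {e a b c d} → Joins G e a b → Joins G e c d → (a ≡ c × b ≡ d) ⊎ (a ≡ d × b ≡ c)
  Joins-unique (inj₁ p) (inj₁ q) = inj₁ (,-injective (trans (sym p) q))
  Joins-unique (inj₁ p) (inj₂ q) = inj₂ (,-injective (trans (sym p) q))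
  Joins-unique (inj₂ p) (inj₁ q) with refl , refl ← ,-injective (trans (sym p) q) = inj₂ (refl , refl)
  Joins-unique (inj₂ p) (inj₂ q) with refl , refl ← ,-injective (trans (sym p) q) = inj₁ (refl , refl)

  Joins? : ∀ e a b → Dec (Joins G e a b)
  Joins? e a b = (ends e ≟ (a , b)) ⊎-dec (ends e ≟ (b , a))
    where
    _≟_ : B.DecidableEquality (Fin n × Fin n)
    _≟_ = ≡-dec Fin._≟_ Fin._≟_

  data Walk (D : Subset n) : Fin n → Fin n → Set where
    nil  : ∀ {a} → a ∉ D → Walk D a a
    cons : ∀ {a b c} e → Joins G e a b → a ∉ D → Walk D b c → Walk D a c

  module _ {D : Subset n} where

    verts : ∀ {a b} → Walk D a b → List (Fin n)
    verts (nil {a} _) = a ∷ []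
    verts (cons {a} _ _ _ w) = a ∷ verts w

    edges : ∀ {a b} → Walk D a b → List (Fin m)
    edges (nil _) = []
    edges (cons e _ _ w) = e ∷ edges w

    len : ∀ {a b} → Walk D a b → ℕ
    len = length ∘ edges

    start∉ : ∀ {a b} → Walk D a b → a ∉ D
    start∉ (nil a∉) = a∉
    start∉ (cons _ _ a∉ _) = a∉

    end∉ : ∀ {a b} → Walk D a b → b ∉ D
    end∉ (nil b∉) = b∉
    end∉ (cons _ _ _ w) = end∉ w

    start∈verts : ∀ {a b} (w : Walk D a b) → a ∈ₗ verts w
    start∈verts (nil _) = here refl
    start∈verts (cons _ _ _ _) = here refl

    _++ʷ_ : ∀ {a b c} → Walk D a b → Walk D b c → Walk D a c
    nil _ ++ʷ w′ = w′
    cons e j a∉ w ++ʷ w′ = cons e j a∉ (w ++ʷ w′)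

    edges-++ʷ : ∀ {a b c} (w : Walk D a b) (w′ : Walk D b c) → edges (w ++ʷ w′) ≡ edges w ++ edges w′
    edges-++ʷ (nil _) w′ = refl
    edges-++ʷ (cons e _ _ w) w′ = cong (e ∷_) (edges-++ʷ w w′)

    Joins⇒∈verts : ∀ {a b e x y} (w : Walk D a b) → e ∈ₗ edges w → Joins G e x y → x ∈ₗ verts w
    Joins⇒∈verts (cons e j _ w) (here refl) j′ with Joins-unique j j′
    ... | inj₁ (refl , _) = here refl
    ... | inj₂ (_ , refl) = there (start∈verts w)
    Joins⇒∈verts (cons _ _ _ w) (there e∈) j′ = there (Joins⇒∈verts w e∈ j′)

    record SplitAtVertex {a b} (w : Walk D a b) (x : Fin n) : Set where
      field
        before : Walk D a x
        after  : Walk D x b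
        verts-before : List (Fin n)
        verts≡ : verts w ≡ verts-before ++ verts after
        edges≡ : edges w ≡ edges before ++ edges after

    splitAtVertex : ∀ {a b x} (w : Walk D a b) → x ∈ₗ verts w → SplitAtVertex w x
    splitAtVertex w@(nil a∉) (here refl) = record
      { before = nil a∉ ; after = w ; verts-before = [] ; verts≡ = refl ; edges≡ = refl }
    splitAtVertex w@(cons _ _ a∉ _) (here refl) = record
      { before = nil a∉ ; after = w ; verts-before = [] ; verts≡ = refl ; edges≡ = refl }
    splitAtVertex (cons {a} e j a∉ w) (there x∈) = record
      { before = cons e j a∉ before ; after = after ; verts-before = a ∷ verts-before
      ; verts≡ = cong (a ∷_) verts≡ ; edges≡ = cong (e ∷_) edges≡ }
      where open SplitAtVertex (splitAtVertex w x∈)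

    len-splitAtVertex : ∀ {a b x} {w : Walk D a b} (sp : SplitAtVertex w x) →
                        len (SplitAtVertex.before sp) + len (SplitAtVertex.after sp) ≡ len w
    len-splitAtVertex {w = w} sp =
      trans (sym (length-++ (edges before))) (cong length (sym edges≡))
      where open SplitAtVertex sp

    record SplitAtEdge {a b} (w : Walk D a b) (e : Fin m) : Set where
      field
        {u v}  : Fin n
        before : Walk D a u
        joins  : Joins G e u v
        after  : Walk D v b
        edges≡ : edges w ≡ edges before ++ e ∷ edges after

    splitAtEdge : ∀ {a b e} (w : Walk D a b) → e ∈ₗ edges w → SplitAtEdge w e
    splitAtEdge (cons e j a∉ w) (here refl) = record { before = nil a∉ ; joins = j ; after = w ; edges≡ = refl }
    splitAtEdge (cons e j a∉ w) (there e∈) = record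
      { before = cons e j a∉ before ; joins = joins ; after = after ; edges≡ = cong (e ∷_) edges≡ }
      where open SplitAtEdge (splitAtEdge w e∈)

    len-pos : ∀ {a b} (w : Walk D a b) → a ≢ b → 1 ≤ len w
    len-pos (nil _) a≢a = ⊥-elim (a≢a refl)
    len-pos (cons _ _ _ _) _ = s≤s z≤n

    walkOfLength? : ∀ L a b → Dec (Σ (Walk D a b) λ w → len w ≡ L)
    walkOfLength? zero a b with a Fin.≟ b | a ∈? D
    ... | yes refl | no a∉ = yes (nil a∉ , refl)
    ... | yes refl | yes a∈ = no λ { (nil a∉ , _) → a∉ a∈ ; (cons _ _ _ _ , ()) }
    ... | no a≢b | _ = no λ { (nil _ , _) → a≢b refl ; (cons _ _ _ _ , ()) }
    walkOfLength? (suc L) a b with a ∈? D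
    ... | yes a∈ = no λ { (nil _ , ()) ; (cons _ _ a∉ _ , _) → a∉ a∈ }
    ... | no a∉ with Fin.any? (λ e → Fin.any? (λ x → Joins? e a x ×-dec walkOfLength? L x b))
    ...   | yes (e , x , j , w , len≡) = yes (cons e j a∉ w , cong suc len≡)
    ...   | no none = no λ { (nil _ , ()) ; (cons e j _ w , len≡) → none (e , _ , j , w , ℕ.suc-injective len≡) }

  StepVia : Subset n → Pred (Fin m) 0ℓ → Rel (Fin n) 0ℓ
  StepVia D Q a b = a ∉ D × b ∉ D × ∃ λ e → Q e × Joins G e a b

  module _ {D : Subset n} {Q : Pred (Fin m) 0ℓ} where

    StepVia-sym : B.Symmetric (StepVia D Q)
    StepVia-sym (a∉ , b∉ , e , qe , j) = b∉ , a∉ , e , qe , Joins-sym j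

    StepVia? : Decidable Q → B.Decidable (StepVia D Q)
    StepVia? Q? a b = ¬? (a ∈? D) ×-dec ¬? (b ∈? D) ×-dec Fin.any? (λ e → Q? e ×-dec Joins? e a b)

    walk⇒Star : ∀ {a b} (w : Walk D a b) → All Q (edges w) → Star (StepVia D Q) a b
    walk⇒Star (nil _) [] = ε
    walk⇒Star (cons e j a∉ w) (qe ∷ qw) = (a∉ , start∉ w , e , qe , j) ◅ walk⇒Star w qw

    Star⇒walk : ∀ {a b} → Star (StepVia D Q) a b → a ∉ D → Σ (Walk D a b) (All Q ∘ edges)
    Star⇒walk ε a∉ = nil a∉ , []
    Star⇒walk ((_ , b∉ , e , qe , j) ◅ steps) a∉ with Star⇒walk steps b∉
    ... | w , qw = cons e j a∉ w , qe ∷ qw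

  StepVia-map : ∀ {D D′ Q Q′} → D ⊆ D′ → (∀ {e} → Q′ e → Q e) → ∀ {a b} → StepVia D′ Q′ a b → StepVia D Q a b
  StepVia-map D⊆D′ Q′⇒Q (a∉ , b∉ , e , qe , j) = a∉ ∘ D⊆D′ , b∉ ∘ D⊆D′ , e , Q′⇒Q qe , j

  Star-start∉ : ∀ {D Q a b} → Star (StepVia D Q) a b → b ∉ D → a ∉ D
  Star-start∉ ε b∉ = b∉
  Star-start∉ ((a∉ , _) ◅ _) _ = a∉

  StepVia-avoid : ∀ {D e s t} → s ∈ D → Joins G e s t → ∀ {a b} → StepVia D U a b → StepVia D (e ≢_) a b
  StepVia-avoid {e = e} s∈D j (a∉ , b∉ , f , _ , j′) = a∉ , b∉ , f , e≢f , j′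
    where
    e≢f : e ≢ f
    e≢f refl with Joins-unique j j′
    ... | inj₁ (refl , _) = a∉ s∈D
    ... | inj₂ (refl , _) = b∉ s∈D

  module _ {D : Subset n} where

    shortcut : ∀ {a b} (w : Walk D a b) → Σ (Walk D a b) λ w′ → Distinct (verts w′) × edges w′ ⊆ₗ edges w
    shortcut (nil a∉) = nil a∉ , (λ ()) ∷ [] , λ ()
    shortcut (cons {a} e j a∉ w) with shortcut w
    ... | w′ , distinct , w′⊆w with any? (a Fin.≟_) (verts w′)
    ...   | yes a∈ = after , Distinct-++ʳ verts-before (subst Distinct verts≡ distinct) ,
                     λ f∈ → there (w′⊆w (subst (_ ∈ₗ_) (sym edges≡) (∈-++⁺ʳ (edges before) f∈)))
      where open SplitAtVertex (splitAtVertex w′ a∈)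
    ...   | no a∉w′ = cons e j a∉ w′ , a∉w′ ∷ distinct ,
                      λ { (here refl) → here refl ; (there f∈) → there (w′⊆w f∈) }

    record IndexedPath {a b} (w : Walk D a b) : Set where
      field
        k      : ℕ
        vs     : Fin (suc k) → Fin n
        es     : Fin k → Fin m
        joins  : ∀ i → Joins G (es i) (vs (inject₁ i)) (vs (suc i))
        vs-inj : Injective _≡_ _≡_ vs
        avoid  : ∀ i → vs i ∉ D
        first  : vs zero ≡ a
        last   : vs (fromℕ k) ≡ b
        vs∈    : ∀ i → vs i ∈ₗ verts w
        es∈    : ∀ i → es i ∈ₗ edges w

    indexedPath : ∀ {a b} (w : Walk D a b) → Distinct (verts w) → IndexedPath w
    indexedPath (nil {a} a∉) _ = record
      { k = 0 ; vs = λ _ → a ; es = λ () ; joins = λ () ; vs-inj = λ { {zero} {zero} _ → refl }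
      ; avoid = λ _ → a∉ ; first = refl ; last = refl ; vs∈ = λ _ → here refl ; es∈ = λ () }
    indexedPath (cons {a} e j a∉ w) (a∉w ∷ distinct) = record
      { k = suc k ; vs = vs′ ; es = es′ ; joins = joins′ ; vs-inj = vs′-inj
      ; avoid = avoid′ ; first = refl ; last = last ; vs∈ = vs′∈ ; es∈ = es′∈ }
      where
      open IndexedPath (indexedPath w distinct)
      vs′ : Fin (suc (suc k)) → Fin n
      vs′ zero = a
      vs′ (suc i) = vs i
      es′ : Fin (suc k) → Fin m
      es′ zero = e
      es′ (suc i) = es i
      joins′ : ∀ i → Joins G (es′ i) (vs′ (inject₁ i)) (vs′ (suc i))
      joins′ zero = subst (Joins G e a) (sym first) j
      joins′ (suc i) = joins i
      vs′∈ : ∀ i → vs′ i ∈ₗ verts (cons e j a∉ w)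
      vs′∈ zero = here refl
      vs′∈ (suc i) = there (vs∈ i)
      vs′-inj : Injective _≡_ _≡_ vs′
      vs′-inj {zero} {zero} _ = refl
      vs′-inj {zero} {suc y} eq = ⊥-elim (a∉w (subst (_∈ₗ verts w) (sym eq) (vs∈ y)))
      vs′-inj {suc x} {zero} eq = ⊥-elim (a∉w (subst (_∈ₗ verts w) eq (vs∈ x)))
      vs′-inj {suc x} {suc y} eq = cong suc (vs-inj eq)
      avoid′ : ∀ i → vs′ i ∉ D
      avoid′ zero = a∉
      avoid′ (suc i) = avoid i
      es′∈ : ∀ i → es′ i ∈ₗ edges (cons e j a∉ w)
      es′∈ zero = here refl
      es′∈ (suc i) = there (es∈ i)

    module Close {u v} {w : Walk D v u} (path : IndexedPath w) {e} (j : Joins G e u v) (e∉w : e ∉ₗ edges w) where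
      open IndexedPath path

      es-inj : Injective _≡_ _≡_ es
      es-inj {i} {i′} eq with Joins-unique (joins i) (subst (λ f → Joins G f _ _) (sym eq) (joins i′))
      ... | inj₁ (p , _) = Fin.inject₁-injective (vs-inj p)
      ... | inj₂ (p , q) = ⊥-elim (ℕ.<-asym (ℕ.≤-reflexive (sym i≡1+i′)) (ℕ.≤-reflexive 1+i≡i′))
        where
        i≡1+i′ : toℕ i ≡ suc (toℕ i′)
        i≡1+i′ = trans (sym (Fin.toℕ-inject₁ i)) (cong toℕ (vs-inj p))
        1+i≡i′ : suc (toℕ i) ≡ toℕ i′
        1+i≡i′ = trans (cong toℕ (vs-inj q)) (Fin.toℕ-inject₁ i′)

      -- the closing edge e carries the last index, from vs (fromℕ k) = u back to vs zero = v
      edgeAt : (i : Fin (suc k)) → Dec (toℕ i < k) → Fin m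
      edgeAt i (yes i<k) = es (fromℕ< i<k)
      edgeAt i (no _) = e

      cycleEdge : Fin (suc k) → Fin m
      cycleEdge i = edgeAt i (toℕ i ℕ.<? k)

      ≮k⇒≡fromℕ : ∀ (i : Fin (suc k)) → ¬ toℕ i < k → i ≡ fromℕ k
      ≮k⇒≡fromℕ i i≮k = Fin.toℕ-injective
        (trans (ℕ.≤-antisym (Fin.toℕ≤pred[n] i) (ℕ.≮⇒≥ i≮k)) (sym (Fin.toℕ-fromℕ k)))

      cycleEdge-joins : ∀ i → Joins G (cycleEdge i) (vs i) (vs (next i))
      cycleEdge-joins i with toℕ i ℕ.<? k
      ... | yes i<k =
        subst₂ (Joins G (es (fromℕ< i<k))) (cong vs inject₁-fromℕ<) (cong vs suc-fromℕ<) (joins (fromℕ< i<k))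
        where
        inject₁-fromℕ< : inject₁ (fromℕ< i<k) ≡ i
        inject₁-fromℕ< = Fin.toℕ-injective (trans (Fin.toℕ-inject₁ _) (Fin.toℕ-fromℕ< i<k))
        suc-fromℕ< : suc (fromℕ< i<k) ≡ fromℕ< (s≤s i<k)
        suc-fromℕ< = Fin.toℕ-injective (trans (cong suc (Fin.toℕ-fromℕ< i<k)) (sym (Fin.toℕ-fromℕ< (s≤s i<k))))
      ... | no i≮k = subst₂ (Joins G e) (trans (sym last) (cong vs (sym (≮k⇒≡fromℕ i i≮k)))) (sym first) j

      edgeAt-inj : ∀ i i′ (d : Dec (toℕ i < k)) (d′ : Dec (toℕ i′ < k)) → edgeAt i d ≡ edgeAt i′ d′ → i ≡ i′
      edgeAt-inj i i′ (yes i<k) (yes i′<k) eq =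
        Fin.toℕ-injective (trans (sym (Fin.toℕ-fromℕ< i<k)) (trans (cong toℕ (es-inj eq)) (Fin.toℕ-fromℕ< i′<k)))
      edgeAt-inj i i′ (yes _) (no _) eq = ⊥-elim (e∉w (subst (_∈ₗ edges w) eq (es∈ _)))
      edgeAt-inj i i′ (no _) (yes _) eq = ⊥-elim (e∉w (subst (_∈ₗ edges w) (sym eq) (es∈ _)))
      edgeAt-inj i i′ (no i≮k) (no i′≮k) eq = trans (≮k⇒≡fromℕ i i≮k) (sym (≮k⇒≡fromℕ i′ i′≮k))

      cycle : CycleAvoiding G D
      cycle = record
        { l = k ; vs = vs ; es = cycleEdge ; vs-inj = vs-inj
        ; es-inj = λ {i} {i′} → edgeAt-inj i i′ (toℕ i ℕ.<? k) (toℕ i′ ℕ.<? k)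
        ; joins = cycleEdge-joins ; avoid = avoid }

      cycleEdge-last : cycleEdge (fromℕ k) ≡ e
      cycleEdge-last with toℕ (fromℕ k) ℕ.<? k
      ... | yes k<k = ⊥-elim (ℕ.<-irrefl (Fin.toℕ-fromℕ k) k<k)
      ... | no _ = refl

  closingEdge⇒SCycle : ∀ {S D e u v} → e ∈ S → Joins G e u v → v ∉ D →
                       Star (StepVia D (e ≢_)) v u → HasSCycle G S D
  closingEdge⇒SCycle {S} {D} {e} e∈S j v∉ steps with Star⇒walk steps v∉
  ... | w , e≢w with shortcut w
  ...   | w′ , distinct , w′⊆w = cycle , fromℕ k , subst (_∈ S) (sym cycleEdge-last) e∈S
    where
    e∉w : e ∉ₗ edges w
    e∉w = All¬⇒¬Any e≢w
    open IndexedPath (indexedPath w′ distinct) using (k)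
    open Close (indexedPath w′ distinct) j (e∉w ∘ w′⊆w)

  module _ {D : Subset n} (C : CycleAvoiding G D) where
    open CycleAvoiding C

    -- the walk around C from vs j back to vs zero, through the indices j, j + 1, ..., l
    record ArcToStart (j : Fin (suc l)) : Set where
      field
        walk        : Walk D (vs j) (vs zero)
        distinct    : Distinct (edges walk)
        edges⊆      : ∀ {f} → f ∈ₗ edges walk → ∃ λ i → toℕ j ≤ toℕ i × f ≡ es i
        edges-cover : ∀ i → toℕ j ≤ toℕ i → es i ∈ₗ edges walk
        verts-cover : ∀ i → toℕ j ≤ toℕ i → vs i ∈ₗ verts walk

    arcToStart : ∀ j d → toℕ j + d ≡ l → ArcToStart j
    arcToStart j zero j+0≡l = record
      { walk = cons (es j) joins-j (avoid j) (nil (avoid zero)) ; distinct = (λ ()) ∷ []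
      ; edges⊆ = λ { (here refl) → j , ℕ.≤-refl , refl }
      ; edges-cover = λ i j≤i → here (cong es (≡j i j≤i))
      ; verts-cover = λ i j≤i → here (cong vs (≡j i j≤i)) }
      where
      j≡l : toℕ j ≡ l
      j≡l = trans (sym (ℕ.+-identityʳ _)) j+0≡l
      joins-j : Joins G (es j) (vs j) (vs zero)
      joins-j = subst (Joins G (es j) (vs j) ∘ vs) (next≡zero j (ℕ.<-irrefl j≡l)) (joins j)
      ≡j : ∀ i → toℕ j ≤ toℕ i → i ≡ j
      ≡j i j≤i = Fin.toℕ-injective (ℕ.≤-antisym (ℕ.≤-trans (Fin.toℕ≤pred[n] i) (ℕ.≤-reflexive (sym j≡l))) j≤i)
    arcToStart j (suc d) j+1+d≡l = record
      { walk = cons (es j) joins-j (avoid j) walk ; distinct = es-j∉ ∷ distinct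
      ; edges⊆ = λ { (here refl) → j , ℕ.≤-refl , refl
                   ; (there f∈) → let (i , j′≤i , f≡) = edges⊆ f∈ in i , ℕ.≤-trans j≤j′ j′≤i , f≡ }
      ; edges-cover = λ i j≤i → cover es edges-cover i j≤i
      ; verts-cover = λ i j≤i → cover vs verts-cover i j≤i }
      where
      j<l : toℕ j < l
      j<l = ℕ.≤-trans (s≤s (ℕ.m≤m+n (toℕ j) d)) (ℕ.≤-reflexive (trans (sym (ℕ.+-suc (toℕ j) d)) j+1+d≡l))
      j′ : Fin (suc l)
      j′ = fromℕ< (s≤s j<l)
      j′≡1+j : toℕ j′ ≡ suc (toℕ j)
      j′≡1+j = Fin.toℕ-fromℕ< (s≤s j<l)
      j≤j′ : toℕ j ≤ toℕ j′
      j≤j′ = ℕ.≤-trans (ℕ.n≤1+n _) (ℕ.≤-reflexive (sym j′≡1+j))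
      open ArcToStart (arcToStart j′ d (trans (cong (_+ d) j′≡1+j) (trans (sym (ℕ.+-suc (toℕ j) d)) j+1+d≡l)))
      joins-j : Joins G (es j) (vs j) (vs j′)
      joins-j = subst (Joins G (es j) (vs j) ∘ vs) (next≡fromℕ< j j<l) (joins j)
      es-j∉ : es j ∉ₗ edges walk
      es-j∉ es-j∈ with edges⊆ es-j∈
      ... | i , j′≤i , es-j≡ = ℕ.<-irrefl (cong toℕ (es-inj es-j≡)) (ℕ.<-≤-trans (ℕ.≤-reflexive (sym j′≡1+j)) j′≤i)
      cover : ∀ {A : Set} (f : Fin (suc l) → A) {xs} → (∀ i → toℕ j′ ≤ toℕ i → f i ∈ₗ xs) →
              ∀ i → toℕ j ≤ toℕ i → f i ∈ₗ f j ∷ xs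
      cover f f∈ i j≤i with toℕ j ℕ.≟ toℕ i
      ... | yes j≡i = here (cong f (Fin.toℕ-injective (sym j≡i)))
      ... | no j≢i = there (f∈ i (ℕ.≤-trans (ℕ.≤-reflexive j′≡1+j) (ℕ.≤∧≢⇒< j≤i j≢i)))

    record ArcsThrough (p i : Fin (suc l)) : Set where
      field
        {u v}  : Fin n
        u∉     : u ∉ D
        v∉     : v ∉ D
        joins  : Joins G (es i) u v
        to-u   : Star (StepVia D (es i ≢_)) (vs p) u
        from-v : Star (StepVia D (es i ≢_)) v (vs p)

    arcsThrough : ∀ p i → ArcsThrough p i
    arcsThrough p i = record
      { u∉ = end∉ before′ ; v∉ = start∉ after′ ; joins = joins-es-i
      ; to-u = walk⇒Star before′ (¬Any⇒All¬ _ e∉before′) ; from-v = walk⇒Star after′ (¬Any⇒All¬ _ e∉after′) }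
      where
      open ArcToStart (arcToStart zero l refl)
      open SplitAtVertex (splitAtVertex walk (verts-cover p z≤n))
      rotated : Walk D (vs p) (vs p)
      rotated = after ++ʷ before
      rotated-edges : edges rotated ≡ edges after ++ edges before
      rotated-edges = edges-++ʷ after before
      rotated-distinct : Distinct (edges rotated)
      rotated-distinct = subst Distinct (sym rotated-edges)
                           (Distinct-++-comm (edges before) (subst Distinct edges≡ distinct))
      es-i∈rotated : es i ∈ₗ edges rotated
      es-i∈rotated = subst (es i ∈ₗ_) (sym rotated-edges)
                       (Any.++-comm (edges before) (edges after) (subst (es i ∈ₗ_) edges≡ (edges-cover i z≤n)))
      open SplitAtEdge (splitAtEdge rotated es-i∈rotated)
        renaming (before to before′; after to after′; edges≡ to rotated-edges≡; joins to joins-es-i)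
      split-distinct : Distinct (edges before′) × Distinct (es i ∷ edges after′)
                       × (∀ {f} → f ∈ₗ edges before′ → f ∉ₗ es i ∷ edges after′)
      split-distinct = Distinct-++⁻ (edges before′) (subst Distinct rotated-edges≡ rotated-distinct)
      e∉before′ : es i ∉ₗ edges before′
      e∉before′ e∈ = proj₂ (proj₂ split-distinct) e∈ (here refl)
      e∉after′ : es i ∉ₗ edges after′
      e∉after′ with proj₁ (proj₂ split-distinct)
      ... | e∉ ∷ _ = e∉

  module _ {D : Subset n} {Q : Pred (Fin m) 0ℓ} (Y : Subset n) where

    record ExitTo (u : Fin n) : Set where
      field
        {y a}  : Fin n
        y∈Y    : y ∈ Y
        y~a    : Adj G y a
        a⇝u    : Star (StepVia (D ∪ Y) Q) a u

    exit-or-avoid : ∀ {a u} → Star (StepVia D Q) a u → u ∉ Y → ExitTo u ⊎ (a ∉ Y × Star (StepVia (D ∪ Y) Q) a u)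
    exit-or-avoid ε u∉Y = inj₂ (u∉Y , ε)
    exit-or-avoid {a} ((a∉D , b∉D , e , qe , j) ◅ steps) u∉Y with exit-or-avoid steps u∉Y
    ... | inj₁ exit = inj₁ exit
    ... | inj₂ (b∉Y , avoiding) with a ∈? Y
    ...   | yes a∈Y = inj₁ (record { y∈Y = a∈Y ; y~a = e , j ; a⇝u = avoiding })
    ...   | no a∉Y = inj₂ (a∉Y , (∉∪ a∉D a∉Y , ∉∪ b∉D b∉Y , e , qe , j) ◅ avoiding)
      where
      ∉∪ : ∀ {x} → x ∉ D → x ∉ Y → x ∉ D ∪ Y
      ∉∪ x∉D x∉Y x∈ = [ x∉D , x∉Y ]′ (x∈p∪q⁻ D Y x∈)

    lastExit : ∀ {x u} → Star (StepVia D Q) x u → x ∈ Y → u ∉ Y → ExitTo u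
    lastExit steps x∈Y u∉Y with exit-or-avoid steps u∉Y
    ... | inj₁ exit = exit
    ... | inj₂ (x∉Y , _) = ⊥-elim (x∉Y x∈Y)

module _ (G : Graph) where
  open Graph G

  SeesAtLeast-≤ : ∀ {S X T Y c c′} → c′ ≤ c → SeesAtLeast G S X T Y c → SeesAtLeast G S X T Y c′
  SeesAtLeast-≤ {c = c} {c′} c′≤c (r , r∉X , apart , interesting , seen) =
    r ∘ inj , r∉X ∘ inj , (λ i j i≢j → apart (inj i) (inj j) (i≢j ∘ Fin.inject≤-injective c′≤c c′≤c i j)) ,
    interesting ∘ inj , seen ∘ inj
    where
    inj : Fin c′ → Fin c
    inj i = inject≤ i c′≤c

  no-exchange : ∀ {S k T X Y W} → IsDominant G S k T X →
                Y ⊆ X → (∀ {y} → y ∈ Y → y ∉ T) → Nonempty Y →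
                W ⊆ T → (∀ {w} → w ∈ W → w ∉ X) → ∣ W ∣ ≤ ∣ Y ∣ →
                ¬ ¬ HasSCycle G S ((X ─ Y) ∪ W)
  no-exchange {S} {k} {T} {X} {Y} {W} ((∣X∣≤k , _) , minimum , dominant)
              Y⊆X Y∩T≡∅ (y , y∈Y) W⊆T W∩X≡∅ ∣W∣≤∣Y∣ acyclic =
    ℕ.<-irrefl refl (begin-strict
      ∣ X ∩ T ∣             <⟨ ℕ.m<m+n ∣ X ∩ T ∣ 0<∣W∣ ⟩
      ∣ X ∩ T ∣ + ∣ W ∣     ≤⟨ ℕ.+-monoˡ-≤ ∣ W ∣ (p⊆q⇒∣p∣≤∣q∣ X∩T⊆rest) ⟩
      ∣ rest ∣ + ∣ W ∣      ≤⟨ ∣p∣+∣q∣≤∣p∪q∣ rest W rest∩W≡∅ ⟩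
      ∣ rest ∪ W ∣          ≤⟨ p⊆q⇒∣p∣≤∣q∣ rest∪W⊆Z∩T ⟩
      ∣ Z ∩ T ∣             ≤⟨ dominant Z solution (ℕ.≤-antisym ∣Z∣≤∣X∣ (minimum Z solution)) ⟩
      ∣ X ∩ T ∣             ∎)
    where
    open ℕ.≤-Reasoning
    Z rest : Subset n
    Z = (X ─ Y) ∪ W
    rest = (X ─ Y) ∩ T
    ∣X─Y∣+∣Y∣≡∣X∣ : ∣ X ─ Y ∣ + ∣ Y ∣ ≡ ∣ X ∣
    ∣X─Y∣+∣Y∣≡∣X∣ = ∣p─q∣+∣q∣≡∣p∣ X Y Y⊆X
    ∣Z∣≤∣X─Y∣+∣W∣ : ∣ Z ∣ ≤ ∣ X ─ Y ∣ + ∣ W ∣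
    ∣Z∣≤∣X─Y∣+∣W∣ = ∣p∪q∣≤∣p∣+∣q∣ (X ─ Y) W
    ∣Z∣≤∣X∣ : ∣ Z ∣ ≤ ∣ X ∣
    ∣Z∣≤∣X∣ = ℕ.≤-trans ∣Z∣≤∣X─Y∣+∣W∣ (ℕ.≤-trans (ℕ.+-monoʳ-≤ _ ∣W∣≤∣Y∣) (ℕ.≤-reflexive ∣X─Y∣+∣Y∣≡∣X∣))
    solution : IsSolution G S k Z
    solution = ℕ.≤-trans ∣Z∣≤∣X∣ ∣X∣≤k , acyclic
    ∣Y∣≤∣W∣ : ∣ Y ∣ ≤ ∣ W ∣
    ∣Y∣≤∣W∣ = ℕ.+-cancelˡ-≤ ∣ X ─ Y ∣ _ _
      (ℕ.≤-trans (ℕ.≤-reflexive ∣X─Y∣+∣Y∣≡∣X∣) (ℕ.≤-trans (minimum Z solution) ∣Z∣≤∣X─Y∣+∣W∣))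
    0<∣W∣ : 0 < ∣ W ∣
    0<∣W∣ = ℕ.≤-trans (ℕ.≤-trans (ℕ.≤-reflexive (sym (∣⁅x⁆∣≡1 y))) (p⊆q⇒∣p∣≤∣q∣ ⁅y⁆⊆Y)) ∣Y∣≤∣W∣
      where
      ⁅y⁆⊆Y : ⁅ y ⁆ ⊆ Y
      ⁅y⁆⊆Y x∈ with refl ← x∈⁅y⁆⇒x≡y y x∈ = y∈Y
    X∩T⊆rest : X ∩ T ⊆ rest
    X∩T⊆rest x∈ with x∈X , x∈T ← x∈p∩q⁻ X T x∈ =
      x∈p∩q⁺ (x∈p∧x∉q⇒x∈p─q x∈X (λ x∈Y → Y∩T≡∅ x∈Y x∈T) , x∈T)
    rest∩W≡∅ : ∀ {x} → x ∈ rest → x ∉ W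
    rest∩W≡∅ x∈ x∈W = W∩X≡∅ x∈W (p─q⊆p X Y (proj₁ (x∈p∩q⁻ (X ─ Y) T x∈)))
    rest∪W⊆Z∩T : rest ∪ W ⊆ Z ∩ T
    rest∪W⊆Z∩T x∈ with x∈p∪q⁻ rest W x∈
    ... | inj₁ x∈rest = let x∈X─Y , x∈T = x∈p∩q⁻ (X ─ Y) T x∈rest in x∈p∩q⁺ (x∈p∪q⁺ (inj₁ x∈X─Y) , x∈T)
    ... | inj₂ x∈W = x∈p∩q⁺ (x∈p∪q⁺ (inj₂ x∈W) , W⊆T x∈W)

  Linked : Subset n → Fin n → Fin n → Set
  Linked X = Star (StepVia G X U)

  Linked? : ∀ X a b → Dec (Linked X a b)
  Linked? X = Star? (StepVia? G (λ _ → yes tt))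

  module _ {S : Subset m} {X : Subset n} where

    Conn-sym : ∀ {a b} → Conn G S X a b → Conn G S X b a
    Conn-sym = reverse (StepVia-sym G)

    Conn⇒Linked : ∀ {a b} → Conn G S X a b → Linked X a b
    Conn⇒Linked = gmap id (StepVia-map G {Q = U} {Q′ = _∉ S} id (λ _ → tt))

    Conn-avoid : ∀ {e a b} → e ∈ S → Conn G S X a b → Star (StepVia G X (e ≢_)) a b
    Conn-avoid {e} e∈S = gmap id (StepVia-map G {Q = e ≢_} {Q′ = _∉ S} id (λ { f∉S refl → f∉S e∈S }))

    Conn? : ∀ a b → Dec (Conn G S X a b)
    Conn? = Star? (StepVia? G (λ e → ¬? (e ∈? S)))

    Linked⇒Interesting : ∀ {T a u} → IsEndpointsOf G S T → Linked X a u → u ∈ T → Interesting G S X T a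
    Linked⇒Interesting _ ε u∈T = _ , u∈T , ε
    Linked⇒Interesting {T} {a} endpoints ((a∉ , b∉ , e , _ , j) ◅ steps) u∈T with e ∈? S
    ... | yes e∈S = a , proj₂ (endpoints a) (e , e∈S , Joins⇒Incident G j) , ε
    ... | no e∉S with t , t∈T , b~t ← Linked⇒Interesting endpoints steps u∈T =
      t , t∈T , (a∉ , b∉ , e , e∉S , j) ◅ b~t

module _ (G : Graph) (S : Subset (Graph.m G)) (k : ℕ) (T X : Subset (Graph.n G))
         (endpoints : IsEndpointsOf G S T) (dominant : IsDominant G S k T X)
         (Y : Subset (Graph.n G)) (Y⊆X─T : Y ⊆ X ─ T) where
  open Graph G

  conn? : ∀ a b → Dec (Conn G S X a b)
  conn? = Conn? G

  SeenInteresting : Fin n → Set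
  SeenInteresting v = v ∉ X × Interesting G S X T v × Sees G S X Y v

  seenInteresting? : ∀ v → Dec (SeenInteresting v)
  seenInteresting? v =
    ¬? (v ∈? X)
    ×-dec Fin.any? (λ t → t ∈? T ×-dec conn? v t)
    ×-dec Fin.any? (λ y → y ∈? Y ×-dec Fin.any? (λ u → conn? v u ×-dec Fin.any? (λ e → Joins? G e y u)))

  record Representatives (L : List (Fin n)) : Set where
    field
      count  : ℕ
      r      : Fin count → Fin n
      seen   : ∀ i → SeenInteresting (r i)
      apart  : ∀ i j → i ≢ j → ¬ Conn G S X (r i) (r j)
      covers : ∀ {v} → v ∈ₗ L → SeenInteresting v → ∃ λ i → Conn G S X (r i) v

    seesAtLeast : SeesAtLeast G S X T Y count
    seesAtLeast = r , proj₁ ∘ seen , apart , proj₁ ∘ proj₂ ∘ seen , proj₂ ∘ proj₂ ∘ seen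

  representatives : ∀ L → Representatives L
  representatives [] = record { count = 0 ; r = λ () ; seen = λ () ; apart = λ () ; covers = λ () }
  representatives (v ∷ L) with representatives L | seenInteresting? v
  ... | R | no unseen = record
    { count = count ; r = r ; seen = seen ; apart = apart
    ; covers = λ { (here refl) seen-v → ⊥-elim (unseen seen-v) ; (there v∈) → covers v∈ } }
    where open Representatives R
  ... | R | yes seen-v with Fin.any? (λ i → conn? (Representatives.r R i) v)
  ...   | yes (i , r~v) = record
    { count = count ; r = r ; seen = seen ; apart = apart
    ; covers = λ { (here refl) _ → i , r~v ; (there v∈) → covers v∈ } }
    where open Representatives R
  ...   | no new = record
    { count = suc count ; r = r′ ; seen = seen′ ; apart = apart′
    ; covers = λ { (here refl) _ → zero , ε ; (there v∈) seen-x → let i , r~x = covers v∈ seen-x in suc i , r~x } }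
    where
    open Representatives R
    r′ : Fin (suc count) → Fin n
    r′ zero = v
    r′ (suc i) = r i
    seen′ : ∀ i → SeenInteresting (r′ i)
    seen′ zero = seen-v
    seen′ (suc i) = seen i
    apart′ : ∀ i j → i ≢ j → ¬ Conn G S X (r′ i) (r′ j)
    apart′ zero zero 0≢0 = ⊥-elim (0≢0 refl)
    apart′ zero (suc j) _ v~r = new (j , Conn-sym G v~r)
    apart′ (suc i) zero _ r~v = new (i , r~v)
    apart′ (suc i) (suc j) i≢j = apart i j (i≢j ∘ cong suc)

  acyclic : ¬ HasSCycle G S X
  acyclic = proj₂ (proj₁ dominant)

  Y∩T≡∅ : ∀ {y} → y ∈ Y → y ∉ T
  Y∩T≡∅ y∈Y = x∈p─q⇒x∉q X T (Y⊆X─T y∈Y)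

  Joins⇒∈T : ∀ {e u v} → e ∈ S → Joins G e u v → u ∈ T
  Joins⇒∈T e∈S j = proj₂ (endpoints _) (_ , e∈S , Joins⇒Incident G j)

  no-closing-walk : ∀ {e u v} → e ∈ S → Joins G e u v → v ∉ X → ¬ Star (StepVia G X (e ≢_)) v u
  no-closing-walk e∈S j v∉X = acyclic ∘ closingEdge⇒SCycle G e∈S j v∉X

  open Representatives (representatives (allFin n))

  r∉X : ∀ i → r i ∉ X
  r∉X = proj₁ ∘ seen

  private opaque
    rootOf : ∀ j → ∃ λ i → Linked G X (r i) (r j) × (∀ i′ → i′ Fin.< i → ¬ Linked G X (r i′) (r j))
    rootOf j = least-Fin (λ i → Linked? G X (r i) (r j)) ε

  root : Fin count → Fin count
  root = proj₁ ∘ rootOf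

  root-linked : ∀ j → Linked G X (r (root j)) (r j)
  root-linked = proj₁ ∘ proj₂ ∘ rootOf

  root≤ : ∀ {i j} → Linked G X (r i) (r j) → root j Fin.≤ i
  root≤ {i} {j} i~j = ℕ.≮⇒≥ (λ i<root → proj₂ (proj₂ (rootOf j)) i i<root i~j)

  root-cong : ∀ {i j} → Linked G X (r i) (r j) → root i ≡ root j
  root-cong {i} {j} i~j = Fin.toℕ-injective (ℕ.≤-antisym
    (root≤ (root-linked j ◅◅ reverse (StepVia-sym G) i~j))
    (root≤ (root-linked i ◅◅ i~j)))

  nonroot⇒0< : ∀ {j} → root j ≢ j → 0 < toℕ j
  nonroot⇒0< {j} nonroot = ℕ.≤-trans (s≤s z≤n) (ℕ.≤∧≢⇒< (root≤ ε) (nonroot ∘ Fin.toℕ-injective))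

  record Shortest (j : Fin count) : Set where
    field
      start   : Fin n
      r~start : Conn G S X (r j) start
      walk    : Walk G X start (r (root j))
      minimal : ∀ {s} → Conn G S X (r j) s → (w : Walk G X s (r (root j))) → len G walk ≤ len G w

  opaque
    shortest : ∀ j → Shortest j
    shortest j with least-ℕ toRoot? {len G w₀} (r j , ε , w₀ , refl)
      where
      ToRoot : ℕ → Set
      ToRoot L = ∃ λ s → Conn G S X (r j) s × Σ (Walk G X s (r (root j))) λ w → len G w ≡ L
      toRoot? : ∀ L → Dec (ToRoot L)
      toRoot? L = Fin.any? (λ s → conn? (r j) s ×-dec walkOfLength? G L s (r (root j)))
      w₀ : Walk G X (r j) (r (root j))
      w₀ = proj₁ (Star⇒walk G (reverse (StepVia-sym G) (root-linked j)) (r∉X j))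
    ... | _ , (s , r~s , w , refl) , shorter = record
      { start = s ; r~start = r~s ; walk = w
      ; minimal = λ r~s′ w′ → ℕ.≮⇒≥ (λ w′<w → shorter w′<w (_ , r~s′ , w′ , refl)) }

  record FirstEdge (j : Fin count) (s : Fin n) : Set where
    field
      {e}    : Fin m
      {s′}   : Fin n
      e∈S    : e ∈ S
      joins  : Joins G e s s′
      s′∉X   : s′ ∉ X
      rest   : Star (StepVia G X (e ≢_)) s′ (r (root j))

  firstEdgeOf : ∀ j → root j ≢ j → ∀ {s} → Conn G S X (r j) s → (w : Walk G X s (r (root j))) →
                (∀ {s′} → Conn G S X (r j) s′ → (w′ : Walk G X s′ (r (root j))) → len G w ≤ len G w′) →
                FirstEdge j s
  firstEdgeOf j nonroot r~s (nil _) _ = ⊥-elim (apart j (root j) (nonroot ∘ sym) r~s)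
  firstEdgeOf j nonroot {s} r~s (cons e jn s∉X w) minimal with e ∈? S
  ... | no e∉S = ⊥-elim (ℕ.<-irrefl refl (minimal (r~s ◅◅ ((s∉X , start∉ G w , e , e∉S , jn) ◅ ε)) w))
  ... | yes e∈S = record
    { e∈S = e∈S ; joins = jn ; s′∉X = start∉ G w ; rest = walk⇒Star G w (¬Any⇒All¬ _ e∉w) }
    where
    e∉w : e ∉ₗ edges G w
    e∉w e∈w = ℕ.<-irrefl refl
      (ℕ.≤-trans (minimal r~s after) (ℕ.≤-trans (ℕ.m≤n+m _ _) (ℕ.≤-reflexive (len-splitAtVertex G split))))
      where
      split : SplitAtVertex G w s
      split = splitAtVertex G w (Joins⇒∈verts G w e∈w jn)
      open SplitAtVertex split

  start : Fin count → Fin n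
  start = Shortest.start ∘ shortest

  firstEdge : ∀ j → root j ≢ j → FirstEdge j (start j)
  firstEdge j nonroot = firstEdgeOf j nonroot r~start walk minimal
    where open Shortest (shortest j)

  Starts : Fin n → Set
  Starts x = ∃ λ j → root j ≢ j × x ≡ start j

  starts? : ∀ x → Dec (Starts x)
  starts? x = Fin.any? (λ j → ¬? (root j Fin.≟ j) ×-dec x Fin.≟ start j)

  W : Subset n
  W = subsetOf starts?

  start∈W : ∀ {j} → root j ≢ j → start j ∈ W
  start∈W nonroot = ∈-subsetOf⁺ starts? (_ , nonroot , refl)

  W⊆T : W ⊆ T
  W⊆T x∈W with j , nonroot , refl ← ∈-subsetOf⁻ starts? x∈W = Joins⇒∈T e∈S joins
    where open FirstEdge (firstEdge j nonroot)

  W∩X≡∅ : ∀ {x} → x ∈ W → x ∉ X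
  W∩X≡∅ x∈W with j , _ , refl ← ∈-subsetOf⁻ starts? x∈W = start∉ G (Shortest.walk (shortest j))

  ∣W∣≤count∸1 : ∣ W ∣ ≤ count ℕ.∸ 1
  ∣W∣≤count∸1 = covered∘suc⇒∣p∣≤c∸1 start W λ x∈W →
    let j , nonroot , x≡ = ∈-subsetOf⁻ starts? x∈W in j , nonroot⇒0< nonroot , x≡

  Bypass : Fin n → Fin n → Set
  Bypass = Star (StepVia G (X ∪ W) U)

  Bypass⇒Linked : ∀ {a b} → Bypass a b → Linked G X a b
  Bypass⇒Linked = gmap id (StepVia-map G {Q = U} {Q′ = U} (p⊆p∪q W) id)

  bypass-avoids : ∀ {j a b} (nonroot : root j ≢ j) → Bypass a b →
                  Star (StepVia G X (FirstEdge.e (firstEdge j nonroot) ≢_)) a b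
  bypass-avoids {j} nonroot =
    gmap id (StepVia-map G (p⊆p∪q W) id ∘ StepVia-avoid G (x∈p∪q⁺ (inj₂ (start∈W nonroot))) joins)
    where open FirstEdge (firstEdge j nonroot)

  same-component : ∀ {i a b e u v} → e ∈ S → Joins G e u v → v ∉ X → Conn G S X (r i) a → Conn G S X (r i) b →
                   Star (StepVia G X (e ≢_)) a u → ¬ Star (StepVia G X (e ≢_)) v b
  same-component e∈S j v∉X r~a r~b a⇝u v⇝b =
    no-closing-walk e∈S j v∉X (v⇝b ◅◅ Conn-avoid G e∈S (Conn-sym G r~b) ◅◅ Conn-avoid G e∈S r~a ◅◅ a⇝u)

  root-bypass : ∀ {i l a b} (nonroot : root l ≢ l) → root l ≡ i →
                Conn G S X (r i) a → Conn G S X (r l) b → ¬ Bypass a b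
  root-bypass {i} {l} nonroot refl r~a r~b a⇝b =
    no-closing-walk e∈S joins s′∉X
      (rest ◅◅ avoid r~a ◅◅ bypass-avoids nonroot a⇝b ◅◅ avoid (Conn-sym G r~b) ◅◅ avoid r~start)
    where
    open FirstEdge (firstEdge l nonroot)
    open Shortest (shortest l) using (r~start)
    avoid : ∀ {x y} → Conn G S X x y → Star (StepVia G X (e ≢_)) x y
    avoid = Conn-avoid G e∈S

  len-walk : Fin count → ℕ
  len-walk j = len G (Shortest.walk (shortest j))

  -- either the first edge of the walk of i closes an S-cycle, or the walk of l passes through start i
  bypass-shorter : ∀ {i l a b} → root i ≢ i → i ≢ l → root i ≡ root l →
                   Conn G S X (r i) a → Conn G S X (r l) b → Bypass a b → len-walk i < len-walk l
  bypass-shorter {i} {l} nonroot i≢l same-root r~a r~b a⇝b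
    with any? (FirstEdge.e (firstEdge i nonroot) Fin.≟_) (edges G (Shortest.walk (shortest l)))
  ... | no e∉walk-l = ⊥-elim (no-closing-walk e∈S joins s′∉X
        (subst (Star _ s′ ∘ r) same-root rest
         ◅◅ reverse (StepVia-sym G) (walk⇒Star G walk-l (¬Any⇒All¬ _ e∉walk-l))
         ◅◅ avoid (Conn-sym G r~start-l) ◅◅ avoid r~b ◅◅ reverse (StepVia-sym G) (bypass-avoids nonroot a⇝b)
         ◅◅ avoid (Conn-sym G r~a) ◅◅ avoid r~start-i))
    where
    open FirstEdge (firstEdge i nonroot)
    open Shortest (shortest l) renaming (walk to walk-l; r~start to r~start-l)
    open Shortest (shortest i) using () renaming (r~start to r~start-i)
    avoid : ∀ {x y} → Conn G S X x y → Star (StepVia G X (e ≢_)) x y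
    avoid = Conn-avoid G e∈S
  ... | yes e∈walk-l = begin-strict
    len-walk i                     ≤⟨ subst (λ t → ∀ (w : Walk G X (start i) (r t)) → len-walk i ≤ len G w) same-root
                                        (Shortest.minimal (shortest i) (Shortest.r~start (shortest i))) after ⟩
    len G after                    <⟨ ℕ.+-monoˡ-≤ (len G after) (len-pos G before start-l≢start-i) ⟩
    len G before + len G after     ≡⟨ len-splitAtVertex G split ⟩
    len-walk l                     ∎
    where
    open ℕ.≤-Reasoning hiding (start)
    open FirstEdge (firstEdge i nonroot)
    split : SplitAtVertex G (Shortest.walk (shortest l)) (start i)
    split = splitAtVertex G _ (Joins⇒∈verts G _ e∈walk-l joins)
    open SplitAtVertex split
    start-l≢start-i : start l ≢ start i
    start-l≢start-i eq = apart i l i≢l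
      (Shortest.r~start (shortest i) ◅◅ Conn-sym G (subst (Conn G S X (r l)) eq (Shortest.r~start (shortest l))))

  record Detour : Set where
    field
      {e}         : Fin m
      {u v a b}   : Fin n
      e∈S    : e ∈ S
      joins  : Joins G e u v
      u∉     : u ∉ X ∪ W
      v∉     : v ∉ X ∪ W
      a⇝u    : Star (StepVia G (X ∪ W) (e ≢_)) a u
      v⇝b    : Star (StepVia G (X ∪ W) (e ≢_)) v b
      Y-a    : ∃ λ y → y ∈ Y × Adj G y a
      Y-b    : ∃ λ y → y ∈ Y × Adj G y b

  module _ (detour : Detour) where
    open Detour detour

    private
      drop-W : ∀ {Q : Pred (Fin m) 0ℓ} {x y} → Star (StepVia G (X ∪ W) Q) x y → Star (StepVia G X Q) x y
      drop-W = gmap id (StepVia-map G (p⊆p∪q W) id)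

      forget-e : ∀ {x y} → Star (StepVia G (X ∪ W) (e ≢_)) x y → Bypass x y
      forget-e = gmap id (StepVia-map G id (λ _ → tt))

      a⇝b : Bypass a b
      a⇝b = forget-e a⇝u ◅◅ (u∉ , v∉ , e , tt , joins) ◅ forget-e v⇝b

      seenVia : ∀ {x t} → Star (StepVia G (X ∪ W) (e ≢_)) x t → t ∉ X ∪ W → t ∈ T →
             (∃ λ y → y ∈ Y × Adj G y x) → SeenInteresting x
      seenVia x⇝t t∉ t∈T (y , y∈Y , adj) =
        (λ x∈X → Star-start∉ G x⇝t t∉ (x∈p∪q⁺ (inj₁ x∈X))) ,
        Linked⇒Interesting G endpoints (Bypass⇒Linked (forget-e x⇝t)) t∈T ,
        (y , y∈Y , _ , ε , adj)

    detour-impossible : ⊥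
    detour-impossible
      with covers (∈-allFin a) (seenVia a⇝u u∉ (Joins⇒∈T e∈S joins) Y-a)
         | covers (∈-allFin b) (seenVia (reverse (StepVia-sym G) v⇝b) v∉ (Joins⇒∈T e∈S (Joins-sym G joins)) Y-b)
    ... | i , r~a | l , r~b with i Fin.≟ l
    ...   | yes refl = same-component e∈S joins (v∉ ∘ x∈p∪q⁺ ∘ inj₁) r~a r~b (drop-W a⇝u) (drop-W v⇝b)
    ...   | no i≢l
      with root-cong (Conn⇒Linked G r~a ◅◅ Bypass⇒Linked a⇝b ◅◅ reverse (StepVia-sym G) (Conn⇒Linked G r~b))
         | root i Fin.≟ i | root l Fin.≟ l
    ...     | same | yes i-root | yes l-root = i≢l (trans (sym i-root) (trans same l-root))
    ...     | same | yes i-root | no l-nonroot = root-bypass l-nonroot (trans (sym same) i-root) r~a r~b a⇝b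
    ...     | same | no i-nonroot | yes l-root =
      root-bypass i-nonroot (trans same l-root) r~b r~a (reverse (StepVia-sym G) a⇝b)
    ...     | same | no i-nonroot | no l-nonroot = ℕ.<-asym
      (bypass-shorter i-nonroot i≢l same r~a r~b a⇝b)
      (bypass-shorter l-nonroot (i≢l ∘ sym) (sym same) r~b r~a (reverse (StepVia-sym G) a⇝b))

  Z : Subset n
  Z = (X ─ Y) ∪ W

  X∪W⊆Z∪Y : X ∪ W ⊆ Z ∪ Y
  X∪W⊆Z∪Y {x} x∈ with x∈p∪q⁻ X W x∈ | x ∈? Y
  ... | _ | yes x∈Y = x∈p∪q⁺ (inj₂ x∈Y)
  ... | inj₁ x∈X | no x∉Y = x∈p∪q⁺ (inj₁ (x∈p∪q⁺ (inj₁ (x∈p∧x∉q⇒x∈p─q x∈X x∉Y))))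
  ... | inj₂ x∈W | no _ = x∈p∪q⁺ (inj₁ (x∈p∪q⁺ (inj₂ x∈W)))

  acyclic-Z : ¬ HasSCycle G S Z
  acyclic-Z (C , i₀ , e∈S) with Fin.any? (λ p → CycleAvoiding.vs C p ∈? Y)
  ... | no avoids-Y = acyclic (C-avoids-X , i₀ , e∈S)
    where
    open CycleAvoiding C
    C-avoids-X : CycleAvoiding G X
    C-avoids-X = record
      { l = l ; vs = vs ; es = es ; vs-inj = vs-inj ; es-inj = es-inj ; joins = joins
      ; avoid = λ i vs∈X → avoid i (x∈p∪q⁺ (inj₁ (x∈p∧x∉q⇒x∈p─q vs∈X (λ vs∈Y → avoids-Y (i , vs∈Y))))) }
  ... | yes (p , vs-p∈Y) = detour-impossible record
    { e∈S = e∈S ; joins = joins ; u∉ = ∉X∪W u∉ u∉Y ; v∉ = ∉X∪W v∉ v∉Y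
    ; a⇝u = shrink a⇝u ; v⇝b = reverse (StepVia-sym G) (shrink b⇝v)
    ; Y-a = _ , y₁∈Y , y₁~a ; Y-b = _ , y₂∈Y , y₂~b }
    where
    open CycleAvoiding C using (vs)
    open ArcsThrough (arcsThrough G C p i₀)
    u∉Y : u ∉ Y
    u∉Y u∈Y = Y∩T≡∅ u∈Y (Joins⇒∈T e∈S joins)
    v∉Y : v ∉ Y
    v∉Y v∈Y = Y∩T≡∅ v∈Y (Joins⇒∈T e∈S (Joins-sym G joins))
    ∉X∪W : ∀ {x} → x ∉ Z → x ∉ Y → x ∉ X ∪ W
    ∉X∪W x∉Z x∉Y x∈ = [ x∉Z , x∉Y ]′ (x∈p∪q⁻ Z Y (X∪W⊆Z∪Y x∈))
    shrink : ∀ {Q : Pred (Fin m) 0ℓ} {x y} → Star (StepVia G (Z ∪ Y) Q) x y → Star (StepVia G (X ∪ W) Q) x y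
    shrink = gmap id (StepVia-map G X∪W⊆Z∪Y id)
    open ExitTo (lastExit G Y to-u vs-p∈Y u∉Y) using (a⇝u) renaming (y∈Y to y₁∈Y; y~a to y₁~a)
    open ExitTo (lastExit G Y (reverse (StepVia-sym G) from-v) vs-p∈Y v∉Y)
      using () renaming (y∈Y to y₂∈Y; y~a to y₂~b; a⇝u to b⇝v)

  too-few : Nonempty Y → ¬ count ≤ ∣ Y ∣ + 1
  too-few nonempty few = no-exchange G dominant (p─q⊆p X T ∘ Y⊆X─T) Y∩T≡∅ nonempty W⊆T W∩X≡∅ ∣W∣≤∣Y∣ acyclic-Z
    where
    ∣W∣≤∣Y∣ : ∣ W ∣ ≤ ∣ Y ∣
    ∣W∣≤∣Y∣ = ℕ.≤-trans ∣W∣≤count∸1 (ℕ.≤-trans (ℕ.∸-monoˡ-≤ 1 few) (ℕ.≤-reflexive (ℕ.m+n∸n≡m ∣ Y ∣ 1)))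

  sees-|Y|+2 : Nonempty Y → SeesAtLeast G S X T Y (∣ Y ∣ + 2)
  sees-|Y|+2 nonempty with (∣ Y ∣ + 2) ℕ.≤? count
  ... | yes enough = SeesAtLeast-≤ G enough seesAtLeast
  ... | no not-enough =
    ⊥-elim (too-few nonempty (ℕ.≤-pred (ℕ.≤-trans (ℕ.≰⇒> not-enough) (ℕ.≤-reflexive (ℕ.+-suc ∣ Y ∣ 1)))))

lemma5 : (G : Graph) (S : Subset (Graph.m G)) (k : ℕ) (T X : Subset (Graph.n G))
         → IsEndpointsOf G S T
         → IsDominant G S k T X
         → (Y : Subset (Graph.n G)) → Nonempty Y → Y ⊆ (X ─ T)
         → SeesAtLeast G S X T Y (∣ Y ∣ + 2)
lemma5 G S k T X endpoints dominant Y nonempty Y⊆X─T = sees-|Y|+2 G S k T X endpoints dominant Y Y⊆X─T nonempty
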